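{- Let $P$ be a poset and let $(P,\perp)$ be its incomparability orthoset. Let $X,Y\subseteq P$. Then $X$ is orthoclosed and $Y=X^\perp$ if and only if $X\perp Y$ and for every $z\in P\setminus(X\cup Y)$ there exist $x\in X$ and $y\in Y$ such that either ($z<x$ and $z<y$) or ($z>x$ and $z>y$).
   Context: The incomparability orthoset of a poset $P$ is $(P,\perp)$ where $x\perp y$ iff $x$ and $y$ are incomparable in $P$. For $X,Y\subseteq P$, $X\perp Y$ means $x\perp y$ for all $x\in X$, $y\in Y$; $X^\perp=\{y\in P\mid y\perp x\text{ for all }x\in X\}$. A subset $X$ is orthoclosed if $X=X^{\perp\perp}$. -}

module Defs where

open import Level using (Level; _⊔_)
open import Data.Product using (_×_; ∃; ∃-syntax)
open import Data.Sum using (_⊎_)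
open import Relation.Nullary using (¬_)
open import Relation.Binary.Bundles using (Poset)
open import Relation.Unary using (Pred; _∈_; _∉_; _≐_)

module Incomparability {c ℓ₁ ℓ₂} (P : Poset c ℓ₁ ℓ₂) where
  open Poset P

  _<_ : Carrier → Carrier → Set (ℓ₁ ⊔ ℓ₂)
  x < y = (x ≤ y) × ¬ (x ≈ y)

  _⊥_ : Carrier → Carrier → Set ℓ₂
  x ⊥ y = ¬ (x ≤ y) × ¬ (y ≤ x)

  _⊥ˢ_ : ∀ {a b} → Pred Carrier a → Pred Carrier b → Set (c ⊔ ℓ₂ ⊔ a ⊔ b)
  X ⊥ˢ Y = ∀ x y → x ∈ X → y ∈ Y → x ⊥ y

  _ᗮ : ∀ {a} → Pred Carrier a → Pred Carrier (c ⊔ ℓ₂ ⊔ a)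
  (X ᗮ) y = ∀ x → x ∈ X → y ⊥ x

  Orthoclosed : ∀ {a} → Pred Carrier a → Set (c ⊔ ℓ₂ ⊔ a)
  Orthoclosed X = X ≐ ((X ᗮ) ᗮ)

-- Two points are orthogonal exactly when they are incomparable, so (classically) a point lies
-- outside Zᗮ iff it is comparable with some element of Z. If X is orthoclosed and Y = Xᗮ, then
-- also X = Yᗮ, so a point outside X ∪ Y is comparable with some x ∈ X and some y ∈ Y; as x and y
-- are incomparable, it cannot lie between them, hence is strictly below or strictly above both.
-- Conversely, a point with this property is comparable with elements of both X and Y, which
-- forces Xᗮ ⊆ Y and Yᗮ ⊆ X, and these inclusions give Y = Xᗮ and Xᗮᗮ ⊆ Yᗮ ⊆ X.
module Submission where

open import Defs
open import Level using (_⊔_; lift; lower)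
open import Data.Product using (_×_; ∃-syntax; _,_; proj₁; proj₂)
open import Data.Sum using (_⊎_; inj₁; inj₂)
open import Relation.Nullary using (¬_; yes; no; contradiction)
open import Relation.Nullary.Decidable using (map′)
open import Relation.Binary.Bundles using (Poset)
open import Relation.Unary using (Pred; _∈_; _∉_; _≐_; _⊆_)
open import Function.Bundles using (_⇔_; mk⇔)
open import Axiom.ExcludedMiddle using (ExcludedMiddle)

excludedMiddle-lower : ∀ {a} b → ExcludedMiddle (a ⊔ b) → ExcludedMiddle a
excludedMiddle-lower b em = map′ (lower {ℓ = b}) lift em

module IncomparabilityProperties {c ℓ₁ ℓ₂} (P : Poset c ℓ₁ ℓ₂) where
  open Poset P
  open Incomparability P

  Comparable : Carrier → Carrier → Set ℓ₂
  Comparable a b = (a ≤ b) ⊎ (b ≤ a)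

  OnSameSide : Carrier → Carrier → Carrier → Set (ℓ₁ ⊔ ℓ₂)
  OnSameSide z x y = ((z < x) × (z < y)) ⊎ ((x < z) × (y < z))

  ⊥-irrefl : ∀ {a} → ¬ (a ⊥ a)
  ⊥-irrefl (a≰a , _) = a≰a refl

  ⊥-sym : ∀ {a b} → a ⊥ b → b ⊥ a
  ⊥-sym (a≰b , b≰a) = b≰a , a≰b

  comparable⇒¬⊥ : ∀ {a b} → Comparable a b → ¬ (a ⊥ b)
  comparable⇒¬⊥ (inj₁ a≤b) (a≰b , _) = a≰b a≤b
  comparable⇒¬⊥ (inj₂ b≤a) (_ , b≰a) = b≰a b≤a

  ⊥-respˡ-≈ : ∀ {a a′ b} → a ≈ a′ → a ⊥ b → a′ ⊥ b
  ⊥-respˡ-≈ a≈a′ (a≰b , b≰a) =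
    (λ a′≤b → a≰b (trans (reflexive a≈a′) a′≤b)) ,
    (λ b≤a′ → b≰a (trans b≤a′ (reflexive (Eq.sym a≈a′))))

  ᗮ-resp-≈ : ∀ {k} (Z : Pred Carrier k) {a a′} → a ≈ a′ → a ∈ Z ᗮ → a′ ∈ Z ᗮ
  ᗮ-resp-≈ Z a≈a′ a∈Zᗮ x x∈Z = ⊥-respˡ-≈ a≈a′ (a∈Zᗮ x x∈Z)

  ≐ᗮ⇒resp-≈ : ∀ {k m} {Z : Pred Carrier k} {W : Pred Carrier m} →
              Z ≐ W ᗮ → ∀ {a a′} → a ≈ a′ → a ∈ Z → a′ ∈ Z
  ≐ᗮ⇒resp-≈ {W = W} (Z⊆Wᗮ , Wᗮ⊆Z) a≈a′ a∈Z = Wᗮ⊆Z (ᗮ-resp-≈ W a≈a′ (Z⊆Wᗮ a∈Z))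

  ᗮ-antitone : ∀ {k m} {Z : Pred Carrier k} {W : Pred Carrier m} → Z ⊆ W → W ᗮ ⊆ Z ᗮ
  ᗮ-antitone Z⊆W a∈Wᗮ x x∈Z = a∈Wᗮ x (Z⊆W x∈Z)

  ⊆-ᗮᗮ : ∀ {k} {Z : Pred Carrier k} → Z ⊆ Z ᗮ ᗮ
  ⊆-ᗮᗮ a∈Z w w∈Zᗮ = ⊥-sym (w∈Zᗮ _ a∈Z)

  ⊥ˢ⇒⊆ᗮ : ∀ {k m} {Z : Pred Carrier k} {W : Pred Carrier m} → Z ⊥ˢ W → W ⊆ Z ᗮ
  ⊥ˢ⇒⊆ᗮ Z⊥W w∈W x x∈Z = ⊥-sym (Z⊥W x _ x∈Z w∈W)

  ⊆ᗮ⇒⊥ˢ : ∀ {k m} {Z : Pred Carrier k} {W : Pred Carrier m} → W ⊆ Z ᗮ → Z ⊥ˢ W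
  ⊆ᗮ⇒⊥ˢ W⊆Zᗮ x w x∈Z w∈W = ⊥-sym (W⊆Zᗮ w∈W x x∈Z)

  onSameSide⇒comparable : ∀ {z x y} → OnSameSide z x y → Comparable z x × Comparable z y
  onSameSide⇒comparable (inj₁ ((z≤x , _) , (z≤y , _))) = inj₁ z≤x , inj₁ z≤y
  onSameSide⇒comparable (inj₂ ((x≤z , _) , (y≤z , _))) = inj₂ x≤z , inj₂ y≤z

  comparable-with-⊥⇒onSameSide : ∀ {z x y} → x ⊥ y → Comparable z x → Comparable z y →
                                 ¬ (z ≈ x) → ¬ (z ≈ y) → OnSameSide z x y
  comparable-with-⊥⇒onSameSide _ (inj₁ z≤x) (inj₁ z≤y) z≉x z≉y = inj₁ ((z≤x , z≉x) , (z≤y , z≉y))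
  comparable-with-⊥⇒onSameSide _ (inj₂ x≤z) (inj₂ y≤z) z≉x z≉y =
    inj₂ ((x≤z , λ x≈z → z≉x (Eq.sym x≈z)) , (y≤z , λ y≈z → z≉y (Eq.sym y≈z)))
  comparable-with-⊥⇒onSameSide (_ , y≰x) (inj₁ z≤x) (inj₂ y≤z) _ _ = contradiction (trans y≤z z≤x) y≰x
  comparable-with-⊥⇒onSameSide (x≰y , _) (inj₂ x≤z) (inj₁ z≤y) _ _ = contradiction (trans x≤z z≤y) x≰y

  module Classical {ℓ} (em : ExcludedMiddle (c ⊔ ℓ₂ ⊔ ℓ)) where

    OutsideOnSameSide : Pred Carrier ℓ → Pred Carrier ℓ → Set (c ⊔ ℓ₁ ⊔ ℓ₂ ⊔ ℓ)
    OutsideOnSameSide X Y =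
      ∀ z → ¬ (z ∈ X ⊎ z ∈ Y) → ∃[ x ] ∃[ y ] (x ∈ X × y ∈ Y × OnSameSide z x y)

    ¬⊥⇒comparable : ∀ {a b} → ¬ (a ⊥ b) → Comparable a b
    ¬⊥⇒comparable {a} {b} ¬a⊥b with excludedMiddle-lower (c ⊔ ℓ) em {a ≤ b}
    ... | yes a≤b = inj₁ a≤b
    ... | no a≰b with excludedMiddle-lower (c ⊔ ℓ) em {b ≤ a}
    ...   | yes b≤a = inj₂ b≤a
    ...   | no b≰a = contradiction (a≰b , b≰a) ¬a⊥b

    ∉ᗮ⇒comparable : (Z : Pred Carrier ℓ) → ∀ {a} → a ∉ Z ᗮ → ∃[ x ] (x ∈ Z × Comparable a x)
    ∉ᗮ⇒comparable Z {a} a∉Zᗮ with excludedMiddle-lower ℓ₂ em {∃[ x ] (x ∈ Z × ¬ (a ⊥ x))}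
    ... | yes (x , x∈Z , ¬a⊥x) = x , x∈Z , ¬⊥⇒comparable ¬a⊥x
    ... | no ∄x = contradiction a∈Zᗮ a∉Zᗮ
      where
      a∈Zᗮ : a ∈ Z ᗮ
      a∈Zᗮ x x∈Z = (λ a≤x → ∄x (x , x∈Z , comparable⇒¬⊥ (inj₁ a≤x)))
                 , (λ x≤a → ∄x (x , x∈Z , comparable⇒¬⊥ (inj₂ x≤a)))

    ᗮ⊆-if-outside-comparable : {X Y : Pred Carrier ℓ} →
      (∀ {z} → z ∉ X → z ∉ Y → ∃[ y ] (y ∈ Y × Comparable z y)) → Y ᗮ ⊆ X
    ᗮ⊆-if-outside-comparable {X} outside {z} z∈Yᗮ with excludedMiddle-lower (c ⊔ ℓ₂) em {z ∈ X}
    ... | yes z∈X = z∈X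
    ... | no z∉X with outside z∉X (λ z∈Y → ⊥-irrefl (z∈Yᗮ z z∈Y))
    ...   | y , y∈Y , z~y = contradiction (z∈Yᗮ y y∈Y) (comparable⇒¬⊥ z~y)

    orthocomplement⇒outsideOnSameSide : {X Y : Pred Carrier ℓ} →
      Orthoclosed X → Y ≐ X ᗮ → OutsideOnSameSide X Y
    orthocomplement⇒outsideOnSameSide {X} {Y} X≐Xᗮᗮ@(_ , Xᗮᗮ⊆X) Y≐Xᗮ@(Y⊆Xᗮ , Xᗮ⊆Y) z z∉X∪Y
      with ∉ᗮ⇒comparable X (λ z∈Xᗮ → z∉X∪Y (inj₂ (Xᗮ⊆Y z∈Xᗮ)))
         | ∉ᗮ⇒comparable Y (λ z∈Yᗮ → z∉X∪Y (inj₁ (Xᗮᗮ⊆X (ᗮ-antitone Xᗮ⊆Y z∈Yᗮ))))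
    ... | x , x∈X , z~x | y , y∈Y , z~y =
      x , y , x∈X , y∈Y ,
      comparable-with-⊥⇒onSameSide (⊆ᗮ⇒⊥ˢ Y⊆Xᗮ x y x∈X y∈Y) z~x z~y
        (λ z≈x → z∉X∪Y (inj₁ (≐ᗮ⇒resp-≈ X≐Xᗮᗮ (Eq.sym z≈x) x∈X)))
        (λ z≈y → z∉X∪Y (inj₂ (≐ᗮ⇒resp-≈ Y≐Xᗮ (Eq.sym z≈y) y∈Y)))

    outsideOnSameSide⇒orthocomplement : {X Y : Pred Carrier ℓ} →
      X ⊥ˢ Y → OutsideOnSameSide X Y → Orthoclosed X × Y ≐ X ᗮ
    outsideOnSameSide⇒orthocomplement {X} {Y} X⊥Y outside =
      (⊆-ᗮᗮ , λ z∈Xᗮᗮ → Yᗮ⊆X (ᗮ-antitone Y⊆Xᗮ z∈Xᗮᗮ)) , (Y⊆Xᗮ , Xᗮ⊆Y)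
      where
      comparableWithBoth : ∀ {z} → z ∉ X → z ∉ Y →
        (∃[ x ] (x ∈ X × Comparable z x)) × (∃[ y ] (y ∈ Y × Comparable z y))
      comparableWithBoth z∉X z∉Y
        with outside _ (λ { (inj₁ z∈X) → z∉X z∈X ; (inj₂ z∈Y) → z∉Y z∈Y })
      ... | x , y , x∈X , y∈Y , sameSide with onSameSide⇒comparable sameSide
      ...   | z~x , z~y = (x , x∈X , z~x) , (y , y∈Y , z~y)

      Y⊆Xᗮ : Y ⊆ X ᗮ
      Y⊆Xᗮ = ⊥ˢ⇒⊆ᗮ X⊥Y

      Xᗮ⊆Y : X ᗮ ⊆ Y
      Xᗮ⊆Y = ᗮ⊆-if-outside-comparable (λ z∉Y z∉X → proj₁ (comparableWithBoth z∉X z∉Y))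

      Yᗮ⊆X : Y ᗮ ⊆ X
      Yᗮ⊆X = ᗮ⊆-if-outside-comparable (λ z∉X z∉Y → proj₂ (comparableWithBoth z∉X z∉Y))

lemma4p1 : ∀ {c ℓ₁ ℓ₂ ℓ} → ExcludedMiddle (c ⊔ ℓ₁ ⊔ ℓ₂ ⊔ ℓ) →
    (P : Poset c ℓ₁ ℓ₂) → let open Poset P in let open Incomparability P in
    (X Y : Pred Carrier ℓ) →
    (Orthoclosed X × (Y ≐ (X ᗮ)))
      ⇔ ((X ⊥ˢ Y) ×
         (∀ z → ¬ (z ∈ X ⊎ z ∈ Y) →
           ∃[ x ] ∃[ y ] (x ∈ X × y ∈ Y ×
             (((z < x) × (z < y)) ⊎ ((x < z) × (y < z))))))
lemma4p1 {ℓ₁ = ℓ₁} em P X Y = mk⇔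
  (λ { (X-closed , Y≐Xᗮ) →
       ⊆ᗮ⇒⊥ˢ (proj₁ Y≐Xᗮ) , orthocomplement⇒outsideOnSameSide X-closed Y≐Xᗮ })
  (λ { (X⊥Y , outside) → outsideOnSameSide⇒orthocomplement X⊥Y outside })
  where
  open IncomparabilityProperties P
  open Classical (excludedMiddle-lower ℓ₁ em)
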